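{- Let $G=(V,E)$ be an acyclic digraph and $k,d\in\mathbb{N}$ with $2\le k\le d$. Let $G^d=(V^d,E^d)$ with $V^d=V\times\{1,\ldots,d\}$ and $E^d=\{((v,i),(w,j)):(v,w)\in E\text{ and }i<j\}$. Then $$(d+1-k)\cdot\mathrm{OPT}(G,k)\le\mathrm{OPT}(G^d,k)\le d\cdot\mathrm{OPT}(G,k).$$
   Context: For a digraph $H$ and $k\in\mathbb{N}$, $\mathrm{OPT}(H,k)$ denotes the minimum number of vertices of $H$ meeting (hitting) all directed paths in $H$ with $k$ vertices. -}

module Defs where

open import Data.Nat using (ℕ; _≤_; _<_)
open import Data.Fin using (Fin; toℕ)
open import Data.Product using (Σ; _×_; _,_)
open import Data.List using (List; []; _∷_; length)
open import Data.List.Relation.Unary.Any using (Any)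
open import Data.List.Relation.Unary.Unique.Propositional using (Unique)
open import Data.List.Membership.Propositional using (_∈_)
open import Relation.Nullary using (¬_)
open import Relation.Binary.PropositionalEquality using (_≡_)

data Walk {V : Set} (E : V → V → Set) : List V → Set where
  walk[] : Walk E []
  walk1  : ∀ v → Walk E (v ∷ [])
  walk∷  : ∀ {u v vs} → E u v → Walk E (v ∷ vs) → Walk E (u ∷ v ∷ vs)

IsPath : {V : Set} → (V → V → Set) → ℕ → List V → Set
IsPath E k p = Walk E p × Unique p × length p ≡ k

data Reach⁺ {V : Set} (E : V → V → Set) : V → V → Set where
  step  : ∀ {u v} → E u v → Reach⁺ E u v
  _then_ : ∀ {u v w} → E u v → Reach⁺ E v w → Reach⁺ E u w

Acyclic : {V : Set} → (V → V → Set) → Set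
Acyclic E = ∀ v → ¬ Reach⁺ E v v

HitsAllPaths : {V : Set} → (V → V → Set) → ℕ → List V → Set
HitsAllPaths {V} E k S = ∀ (p : List V) → IsPath E k p → Any (_∈ S) p

IsOPT : {V : Set} → (V → V → Set) → ℕ → ℕ → Set
IsOPT {V} E k m =
  Σ (List V) (λ S → Unique S × HitsAllPaths E k S × length S ≡ m)
  × (∀ (S : List V) → Unique S → HitsAllPaths E k S → m ≤ length S)

-- The blow-up G^d on V × {1,…,d} (levels indexed by Fin d):
-- (v,i) → (w,j) iff v → w in G and i < j.
Blowup : {V : Set} → (V → V → Set) → (d : ℕ) → (V × Fin d) → (V × Fin d) → Set
Blowup E d (v , i) (w , j) = E v w × toℕ i < toℕ j

-- Fix a hitting set T of the k-paths of G^d and one of the d + 1 - k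
-- windows t, …, t + k - 1 of levels.  For a vertex v let h(v) ≤ k - 1 be greatest
-- such that some T-avoiding path of G^d with h(v) vertices lies below level t + h(v)
-- and ends at a G-predecessor of v, and let S_t = {v : (v, t + h(v)) ∈ T}.  Off S_t
-- we have h(v) < k - 1, since otherwise that path extended by (v, t + h(v)) is a
-- T-avoiding k-path, and h increases strictly along every edge leaving a vertex off
-- S_t.  Hence S_t hits all k-paths of G and |S_t| ≥ OPT(G,k).  As h does not
-- decrease when t grows, the sets {(v, t + h(v)) : v ∈ S_t} ⊆ T are pairwise
-- disjoint.  Choosing h needs excluded middle, so it is done under a double
-- negation, which the decidable conclusion absorbs.  If S hits the k-paths of G then S × {1,…,d} hits those of G^d: the
-- first coordinates of a path of G^d form a walk of G, a path as G is acyclic.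
module Submission where

open import Defs
open import Data.Nat using (ℕ; zero; suc; _≤_; _<_; _+_; _∸_; _*_; z≤n; s≤s; s≤s⁻¹; _≤?_)
open import Data.Nat.Properties
open import Data.Fin as Fin using (Fin; toℕ; fromℕ<)
open import Data.Fin.Properties using (toℕ-fromℕ<; toℕ<n)
open import Data.Product using (Σ-syntax; _×_; _,_; proj₁; proj₂)
open import Data.Product.Properties using (≡-dec)
open import Data.Sum using (inj₁; inj₂)
open import Data.Unit using (⊤; tt)
open import Data.List
  using (List; []; _∷_; _++_; _∷ʳ_; length; map; filter; concat; tabulate; allFin; cartesianProduct)
open import Data.List.Properties using (length-++; length-map; length-tabulate)
open import Data.List.Relation.Unary.Any as Any using (here; there; any?)
import Data.List.Relation.Unary.Any.Properties as Any
open import Data.List.Relation.Unary.All as All using (All; []; _∷_)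
open import Data.List.Relation.Unary.All.Properties using (¬Any⇒All¬; All¬⇒¬Any; ∷ʳ⁺; tabulate⁺)
open import Data.List.Relation.Unary.AllPairs using ([]; _∷_)
open import Data.List.Relation.Unary.AllPairs.Properties using (tabulate⁺-<)
open import Data.List.Relation.Unary.Unique.Propositional using (Unique)
import Data.List.Relation.Unary.Unique.Propositional.Properties as Unique
open import Data.List.Relation.Binary.Disjoint.Propositional using (Disjoint)
open import Data.List.Relation.Binary.Subset.Propositional using (_⊆_)
open import Data.List.Membership.Propositional using (_∈_; _∉_)
open import Data.List.Membership.Propositional.Properties
import Data.List.Membership.DecPropositional as DecMembership
open import Effect.Monad using (RawMonad)
import Level
open import Function using (_∘_)
open import Relation.Nullary using (¬_; Dec; yes; no)
open import Relation.Nullary.Decidable using (decidable-stable; ¬¬-excluded-middle)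
open import Relation.Nullary.Negation using (¬¬-Monad; contradiction)
open import Relation.Binary.PropositionalEquality

open RawMonad (¬¬-Monad {Level.zero}) using (pure; _<$>_; _>>=_)

m<n∸o⇒m+o<n : ∀ {m n o} → m < n ∸ o → m + o < n
m<n∸o⇒m+o<n {m} lt = m≤o∸n⇒m+n≤o (suc m) (<⇒≤ (m∸n≢0⇒n<m (m<n⇒n≢0 lt))) lt

¬¬-shift-Fin : ∀ {n} {P : Fin n → Set} → (∀ i → ¬ ¬ P i) → ¬ ¬ (∀ i → P i)
¬¬-shift-Fin {zero}  _  = pure λ ()
¬¬-shift-Fin {suc n} ¬¬P = do
  P₀ ← ¬¬P Fin.zero
  Pₛ ← ¬¬-shift-Fin (¬¬P ∘ Fin.suc)
  pure λ { Fin.zero → P₀ ; (Fin.suc i) → Pₛ i }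

record Greatest (P : ℕ → Set) (K : ℕ) : Set where
  field
    value   : ℕ
    value≤K : value ≤ K
    holds   : P value
    maximal : ∀ {q} → q ≤ K → P q → q ≤ value

¬¬-greatest : {P : ℕ → Set} → P 0 → ∀ K → ¬ ¬ Greatest P K
¬¬-greatest P₀ zero = pure record { value = 0 ; value≤K = z≤n ; holds = P₀ ; maximal = λ q≤0 _ → q≤0 }
¬¬-greatest {P} P₀ (suc K) = ¬¬-excluded-middle >>= λ where
    (yes P[1+K]) → pure record { value = suc K ; value≤K = ≤-refl ; holds = P[1+K] ; maximal = λ q≤1+K _ → q≤1+K }
    (no ¬P[1+K]) → extend ¬P[1+K] <$> ¬¬-greatest P₀ K
  where
  extend : ¬ P (suc K) → Greatest P K → Greatest P (suc K)
  extend ¬P[1+K] g = record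
    { value = value ; value≤K = m≤n⇒m≤1+n value≤K ; holds = holds ; maximal = maximal′ }
    where
    open Greatest g
    maximal′ : ∀ {q} → q ≤ suc K → P q → q ≤ value
    maximal′ q≤1+K Pq with m≤n⇒m<n∨m≡n q≤1+K
    ... | inj₁ q<1+K = maximal (s≤s⁻¹ q<1+K) Pq
    ... | inj₂ refl  = contradiction Pq ¬P[1+K]

module _ {A : Set} where

  length-∷ʳ : ∀ (xs : List A) {x} → length (xs ∷ʳ x) ≡ suc (length xs)
  length-∷ʳ xs = trans (length-++ xs) (+-comm (length xs) 1)

  Unique-⊆⇒length≤ : ∀ {xs ys : List A} → Unique xs → xs ⊆ ys → length xs ≤ length ys
  Unique-⊆⇒length≤ {[]}     _ _ = z≤n
  Unique-⊆⇒length≤ {x ∷ xs} {ys} (x∉xs ∷ xs!) xs⊆ys with ∈-∃++ (xs⊆ys (here refl))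
  ... | ys₁ , ys₂ , refl = begin
      suc (length xs)               ≤⟨ s≤s (Unique-⊆⇒length≤ xs! xs⊆ys₁ys₂) ⟩
      suc (length (ys₁ ++ ys₂))     ≡⟨ cong suc (length-++ ys₁) ⟩
      suc (length ys₁ + length ys₂) ≡⟨ +-suc (length ys₁) (length ys₂) ⟨
      length ys₁ + length (x ∷ ys₂) ≡⟨ length-++ ys₁ ⟨
      length (ys₁ ++ x ∷ ys₂)       ∎
    where
    open ≤-Reasoning
    xs⊆ys₁ys₂ : xs ⊆ ys₁ ++ ys₂
    xs⊆ys₁ys₂ {y} y∈xs with ∈-++⁻ ys₁ (xs⊆ys (there y∈xs))
    ... | inj₁ y∈ys₁         = ∈-++⁺ˡ y∈ys₁
    ... | inj₂ (here refl)   = contradiction refl (All.lookup x∉xs y∈xs)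
    ... | inj₂ (there y∈ys₂) = ∈-++⁺ʳ ys₁ y∈ys₂

  length-cartesianProduct : ∀ {B : Set} (xs : List A) (ys : List B) →
                            length (cartesianProduct xs ys) ≡ length xs * length ys
  length-cartesianProduct []       ys = refl
  length-cartesianProduct (x ∷ xs) ys = begin
      length (map (x ,_) ys ++ cartesianProduct xs ys)         ≡⟨ length-++ (map (x ,_) ys) ⟩
      length (map (x ,_) ys) + length (cartesianProduct xs ys) ≡⟨ cong₂ _+_ (length-map _ ys) (length-cartesianProduct xs ys) ⟩
      length ys + length xs * length ys                        ∎
    where open ≡-Reasoning

  length-concat-tabulate : ∀ {r m} (B : Fin r → List A) → (∀ i → m ≤ length (B i)) →
                           r * m ≤ length (concat (tabulate B))
  length-concat-tabulate {zero}  B m≤ = z≤n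
  length-concat-tabulate {suc r} {m} B m≤ = begin
      m + r * m ≤⟨ +-mono-≤ (m≤ Fin.zero) (length-concat-tabulate (B ∘ Fin.suc) (m≤ ∘ Fin.suc)) ⟩
      length (B Fin.zero) + length (concat (tabulate (B ∘ Fin.suc))) ≡⟨ length-++ (B Fin.zero) ⟨
      length (concat (tabulate B)) ∎
    where open ≤-Reasoning

  disjoint-blocks⇒length≥ : ∀ {r m} (ys : List A) (B : Fin r → List A) →
                           (∀ i → Unique (B i)) → (∀ {i j} → i Fin.< j → Disjoint (B i) (B j)) →
                           (∀ i → B i ⊆ ys) → (∀ i → m ≤ length (B i)) → r * m ≤ length ys
  disjoint-blocks⇒length≥ ys B B! B-disjoint B⊆ys m≤ =
    ≤-trans (length-concat-tabulate B m≤)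
            (Unique-⊆⇒length≤ (Unique.concat⁺ (tabulate⁺ B!) (tabulate⁺-< B-disjoint)) concat⊆ys)
    where
    concat⊆ys : concat (tabulate B) ⊆ ys
    concat⊆ys y∈concat with ∈-concat⁻′ (tabulate B) y∈concat
    ... | _ , y∈xs , xs∈tabulate with ∈-tabulate⁻ xs∈tabulate
    ...   | i , refl = B⊆ys i y∈xs

module _ {V : Set} {E : V → V → Set} where

  walk-tail : ∀ {x xs} → Walk E (x ∷ xs) → Walk E xs
  walk-tail (walk1 _)   = walk[]
  walk-tail (walk∷ _ w) = w

  walk-∷ʳ : ∀ xs {y z} → Walk E (xs ∷ʳ y) → E y z → Walk E (xs ∷ʳ y ∷ʳ z)
  walk-∷ʳ []            (walk1 _)    e = walk∷ e (walk1 _)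
  walk-∷ʳ (_ ∷ [])      (walk∷ e′ w) e = walk∷ e′ (walk-∷ʳ [] w e)
  walk-∷ʳ (_ ∷ x′ ∷ xs) (walk∷ e′ w) e = walk∷ e′ (walk-∷ʳ (x′ ∷ xs) w e)

  walk⇒Reach⁺ : ∀ {u vs w} → Walk E (u ∷ vs) → w ∈ vs → Reach⁺ E u w
  walk⇒Reach⁺ (walk∷ e _) (here refl) = step e
  walk⇒Reach⁺ (walk∷ e w) (there w∈)  = e then walk⇒Reach⁺ w w∈

  Acyclic⇒walk-unique : Acyclic E → ∀ {vs} → Walk E vs → Unique vs
  Acyclic⇒walk-unique acyclic {[]}     _ = []
  Acyclic⇒walk-unique acyclic {u ∷ vs} w =
    All.tabulate (λ {v} v∈vs u≡v → acyclic u (subst (Reach⁺ E u) (sym u≡v) (walk⇒Reach⁺ w v∈vs)))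
    ∷ Acyclic⇒walk-unique acyclic (walk-tail w)

  walk-map : ∀ {W : Set} {F : W → W → Set} (f : V → W) → (∀ {u v} → E u v → F (f u) (f v)) →
             ∀ {vs} → Walk E vs → Walk F (map f vs)
  walk-map f hom walk[]      = walk[]
  walk-map f hom (walk1 v)   = walk1 (f v)
  walk-map f hom (walk∷ e w) = walk∷ (hom e) (walk-map f hom w)

module _ {V : Set} {E : V → V → Set} {d : ℕ} where

  Reach⁺-Blowup⇒level< : ∀ {x y} → Reach⁺ (Blowup E d) x y → toℕ (proj₂ x) < toℕ (proj₂ y)
  Reach⁺-Blowup⇒level< (step (_ , i<j))   = i<j
  Reach⁺-Blowup⇒level< ((_ , i<j) then r) = <-trans i<j (Reach⁺-Blowup⇒level< r)

  Blowup-acyclic : Acyclic (Blowup E d)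
  Blowup-acyclic x = <-irrefl refl ∘ Reach⁺-Blowup⇒level<

  IsPath-Blowup⇒IsPath-proj₁ : Acyclic E → ∀ {k p} → IsPath (Blowup E d) k p → IsPath E k (map proj₁ p)
  IsPath-Blowup⇒IsPath-proj₁ acyclic {p = p} (w , _ , length≡k) =
    w′ , Acyclic⇒walk-unique acyclic w′ , trans (length-map proj₁ p) length≡k
    where w′ = walk-map proj₁ proj₁ w

  HitsAllPaths-Blowup : Acyclic E → ∀ {k S} → HitsAllPaths E k S →
                        HitsAllPaths (Blowup E d) k (cartesianProduct S (allFin d))
  HitsAllPaths-Blowup acyclic S-hits p p-path =
    Any.map (λ v∈S → ∈-cartesianProduct⁺ v∈S (∈-allFin _))
            (Any.map⁻ (S-hits (map proj₁ p) (IsPath-Blowup⇒IsPath-proj₁ acyclic p-path)))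

  OPT-Blowup-≤ : Acyclic E → ∀ {k m md} → IsOPT E k m → IsOPT (Blowup E d) k md → md ≤ d * m
  OPT-Blowup-≤ acyclic {m = m} {md} ((S , S! , S-hits , |S|≡m) , _) (_ , minimal) = begin
      md ≤⟨ minimal (cartesianProduct S (allFin d))
                   (Unique.cartesianProduct⁺ S! (Unique.allFin⁺ d))
                   (HitsAllPaths-Blowup acyclic S-hits) ⟩
      length (cartesianProduct S (allFin d)) ≡⟨ length-cartesianProduct S (allFin d) ⟩
      length S * length (allFin d)           ≡⟨ cong₂ _*_ |S|≡m (length-tabulate _) ⟩
      m * d                                  ≡⟨ *-comm m d ⟩
      d * m                                  ∎
    where open ≤-Reasoning

-- Here k = suc k₁, and window t : Fin (d ∸ k₁) consists of the levels t, …, t + k₁.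
module LowerBound {n d k₁ : ℕ} (E : Fin n → Fin n → Set)
                  (T : List (Fin n × Fin d)) (T-hits : HitsAllPaths (Blowup E d) (suc k₁) T) where

  level : Fin n × Fin d → ℕ
  level = toℕ ∘ proj₂

  record Chain (x : Fin n × Fin d) (q : ℕ) : Set where
    constructor chain
    field
      prefix  : List (Fin n × Fin d)
      walk    : Walk (Blowup E d) (prefix ∷ʳ x)
      avoids  : All (_∉ T) (prefix ∷ʳ x)
      length≡ : length prefix ≡ q

  start : ∀ {x} → x ∉ T → Chain x 0
  start x∉T = chain [] (walk1 _) (x∉T ∷ []) refl

  extend : ∀ {x y q} → Chain y q → Blowup E d y x → x ∉ T → Chain x (suc q)
  extend (chain prefix walk avoids length≡) e x∉T =
    chain (prefix ∷ʳ _) (walk-∷ʳ prefix walk e) (∷ʳ⁺ avoids x∉T) (trans (length-∷ʳ prefix) (cong suc length≡))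

  no-Chain : ∀ {x} → ¬ Chain x k₁
  no-Chain (chain prefix walk avoids length≡) =
    All¬⇒¬Any avoids (T-hits _ (walk , Acyclic⇒walk-unique Blowup-acyclic walk
                                     , trans (length-∷ʳ prefix) (cong suc length≡)))

  ChainInto : Fin n → ℕ → ℕ → Set
  ChainInto v L zero    = ⊤
  ChainInto v L (suc q) = Σ[ x ∈ Fin n × Fin d ] Chain x q × E (proj₁ x) v × level x < L

  ChainInto-mono : ∀ {v L L′} p → L ≤ L′ → ChainInto v L p → ChainInto v L′ p
  ChainInto-mono zero    _    _                 = tt
  ChainInto-mono (suc q) L≤L′ (x , c , e , x<L) = x , c , e , <-≤-trans x<L L≤L′

  Height : ℕ → Fin n → Set
  Height t v = Greatest (λ p → ChainInto v (t + p) p) k₁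

  module Windows (height : (t : Fin (d ∸ k₁)) (v : Fin n) → Height (toℕ t) v) where

    h : Fin (d ∸ k₁) → Fin n → ℕ
    h t v = Greatest.value (height t v)

    lvl : Fin (d ∸ k₁) → Fin n → Fin d
    lvl t v = fromℕ< (≤-<-trans (+-monoʳ-≤ (toℕ t) (Greatest.value≤K (height t v)))
                                 (m<n∸o⇒m+o<n (toℕ<n t)))

    toℕ-lvl : ∀ t v → toℕ (lvl t v) ≡ toℕ t + h t v
    toℕ-lvl t v = toℕ-fromℕ< _

    _∈T? : ∀ x → Dec (x ∈ T)
    x ∈T? = DecMembership._∈?_ (≡-dec Fin._≟_ Fin._≟_) x T

    S : Fin (d ∸ k₁) → List (Fin n)
    S t = filter (λ v → (v , lvl t v) ∈T?) (allFin n)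

    ∈S⇒∈T : ∀ {t v} → v ∈ S t → (v , lvl t v) ∈ T
    ∈S⇒∈T v∈S = proj₂ (∈-filter⁻ _ {xs = allFin n} v∈S)

    ∉S⇒∉T : ∀ {t v} → v ∉ S t → (v , lvl t v) ∉ T
    ∉S⇒∉T {v = v} v∉S ∈T = v∉S (∈-filter⁺ _ (∈-allFin v) ∈T)

    chain-at : ∀ {t v} → v ∉ S t → Chain (v , lvl t v) (h t v)
    chain-at {t} {v} v∉S = close (h t v) (Greatest.holds (height t v)) (toℕ-lvl t v) (∉S⇒∉T v∉S)
      where
      close : ∀ p {ℓ} → ChainInto v (toℕ t + p) p → toℕ ℓ ≡ toℕ t + p → (v , ℓ) ∉ T → Chain (v , ℓ) p
      close zero    _                 _   ∉T = start ∉T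
      close (suc q) (x , c , e , x<ℓ) ℓ≡ ∉T = extend c (e , subst (level x <_) (sym ℓ≡) x<ℓ) ∉T

    h<k₁ : ∀ {t v} → v ∉ S t → h t v < k₁
    h<k₁ {t} {v} v∉S with m≤n⇒m<n∨m≡n (Greatest.value≤K (height t v))
    ... | inj₁ h<k₁ = h<k₁
    ... | inj₂ h≡k₁ = contradiction (subst (Chain _) h≡k₁ (chain-at v∉S)) no-Chain

    h-step : ∀ {t u v} → u ∉ S t → E u v → h t u < h t v
    h-step {t} {u} {v} u∉S e =
      Greatest.maximal (height t v) (h<k₁ u∉S) ((u , lvl t u) , chain-at u∉S , e , lvl-below)
      where
      lvl-below : toℕ (lvl t u) < toℕ t + suc (h t u)
      lvl-below = subst (_< toℕ t + suc (h t u)) (sym (toℕ-lvl t u)) (+-monoʳ-< (toℕ t) (n<1+n (h t u)))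

    avoiding-walk-short : ∀ {t u vs} → Walk E (u ∷ vs) → All (_∉ S t) (u ∷ vs) → h t u + length vs < k₁
    avoiding-walk-short {t} {u} {[]} _ (u∉S ∷ []) = subst (_< k₁) (sym (+-identityʳ (h t u))) (h<k₁ u∉S)
    avoiding-walk-short {t} {u} {v ∷ vs} (walk∷ e w) (u∉S ∷ avoids) = begin-strict
        h t u + suc (length vs) ≡⟨ +-suc (h t u) (length vs) ⟩
        suc (h t u) + length vs ≤⟨ +-monoˡ-≤ (length vs) (h-step u∉S e) ⟩
        h t v + length vs       <⟨ avoiding-walk-short w avoids ⟩
        k₁                      ∎
      where open ≤-Reasoning

    S-hits : ∀ t → HitsAllPaths E (suc k₁) (S t)
    S-hits t p (w , _ , length≡) with any? (λ v → DecMembership._∈?_ Fin._≟_ v (S t)) p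
    ... | yes hit = hit
    ... | no ¬hit = contradiction length≡ (avoiding-path-short p w (¬Any⇒All¬ p ¬hit))
      where
      avoiding-path-short : ∀ p → Walk E p → All (_∉ S t) p → length p ≢ suc k₁
      avoiding-path-short (u ∷ vs) w avoids refl = m+n≮n (h t u) k₁ (avoiding-walk-short w avoids)

    h-mono : ∀ {s t v} → toℕ s ≤ toℕ t → h s v ≤ h t v
    h-mono {s} {t} {v} s≤t = Greatest.maximal (height t v) (Greatest.value≤K (height s v))
      (ChainInto-mono (h s v) (+-monoˡ-≤ (h s v) s≤t) (Greatest.holds (height s v)))

    lvl-strict : ∀ {s t v} → s Fin.< t → toℕ (lvl s v) < toℕ (lvl t v)
    lvl-strict {s} {t} {v} s<t rewrite toℕ-lvl s v | toℕ-lvl t v = +-mono-<-≤ s<t (h-mono (<⇒≤ s<t))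

    block : Fin (d ∸ k₁) → List (Fin n × Fin d)
    block t = map (λ v → v , lvl t v) (S t)

    block-unique : ∀ t → Unique (block t)
    block-unique t = Unique.map⁺ (cong proj₁) (Unique.filter⁺ _ (Unique.allFin⁺ n))

    block⊆T : ∀ t → block t ⊆ T
    block⊆T t x∈block with ∈-map⁻ _ x∈block
    ... | _ , v∈S , refl = ∈S⇒∈T v∈S

    blocks-disjoint : ∀ {s t} → s Fin.< t → Disjoint (block s) (block t)
    blocks-disjoint s<t (x∈s , x∈t) with ∈-map⁻ _ x∈s | ∈-map⁻ _ x∈t
    ... | _ , _ , refl | _ , _ , eq with cong proj₁ eq
    ...   | refl = <-irrefl (cong (toℕ ∘ proj₂) eq) (lvl-strict s<t)

    length-T : ∀ {m} → IsOPT E (suc k₁) m → (d ∸ k₁) * m ≤ length T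
    length-T (_ , minimal) = disjoint-blocks⇒length≥ T block block-unique blocks-disjoint block⊆T
      λ t → subst (_ ≤_) (sym (length-map _ (S t)))
                  (minimal (S t) (Unique.filter⁺ _ (Unique.allFin⁺ n)) (S-hits t))

OPT-Blowup-≥ : ∀ {n d k₁ m md} {E : Fin n → Fin n → Set} →
               IsOPT E (suc k₁) m → IsOPT (Blowup E d) (suc k₁) md → (d ∸ k₁) * m ≤ md
OPT-Blowup-≥ {E = E} G-opt ((T , _ , T-hits , |T|≡md) , _) =
  subst (_ ≤_) |T|≡md (decidable-stable (_ ≤? _)
    ((λ height → Windows.length-T height G-opt) <$> ¬¬-shift-Fin λ _ → ¬¬-shift-Fin λ _ → ¬¬-greatest tt _))
  where open LowerBound E T T-hits

lemma19 : (n : ℕ) (E : Fin n → Fin n → Set) → Acyclic E →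
    (k d : ℕ) → 2 ≤ k → k ≤ d →
    (m md : ℕ) → IsOPT E k m → IsOPT (Blowup E d) k md →
    ((d + 1) ∸ k) * m ≤ md × md ≤ d * m
lemma19 n E acyclic zero       d () _ m md G-opt Gᵈ-opt
lemma19 n E acyclic k@(suc k₁) d _  _ m md G-opt Gᵈ-opt =
  subst (λ r → r * m ≤ md) (cong (_∸ k) (+-comm 1 d)) (OPT-Blowup-≥ G-opt Gᵈ-opt)
  , OPT-Blowup-≤ acyclic G-opt Gᵈ-opt
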